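{- Given formulae $A$ and $B$ defined over the same locus $I$: if for all $x\in I$, $\mathtt{cst}_x(A)\leq\mathtt{cst}_x(B)$, then $A\leq B$.
   Context: For $x\in I$, $\mathtt{cst}_x:\{*\}\to I$ is the function $*\mapsto x$, and $\mathtt{cst}_x(A)$ is the base change of $A$ along it. Formulae of IndLL: $A ::= f(X)\mid \mathbf 1\mid \top\mid A\otimes B\mid A\,\&_{i,j}\,B\mid !_u A$ and duals $f(X)^\bot,\bot,\mathbf 0, A ⅋ B, A\oplus_{i,j}B, ?_uA$, with quasi-injective annotations and a locus ($f(X)$ over $I$ when $f:I\to J$; $!_uA$ over $I$ when $A$ over $J$, $u:J\to I$; $\otimes$ keeps the locus; $\oplus_{i,j},\&_{i,j}$ over $K$ with $i:I\to K,j:J\to K$ coproduct injections, $A$ over $I$, $B$ over $J$). Base change $f(A)$ for $f:I\to J$: distributes over multiplicatives, $f(g(X))=(g\circ f)(X)$, and $f(!_uA)=!_{u'}f'(A)$, $f(A\,\&_{i,j}\,B)=p_A(A)\,\&_{q_A,q_B}\,p_B(B)$ with $u',f'$ (resp. $q,p$) the projections of the pullback of $f$ with $u$ (resp. with $i$, $j$). Subtyping $\leq$ is generated by: $!_uA\leq !_{u\circ g}A'$ if $g(A)\leq A'$; $A\,\&_{i,j}\,B\leq A'\,\&_{i',j'}\,B'$ if pullbacks of $(i,j')$, $(j,i')$ are empty and $p(A)\leq p'(A')$, $r(B)\leq r'(B')$ for the projections of the pullbacks of $(i,i')$, $(j,j')$; reflexivity on units and variables; monotonicity of $\otimes$; and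 duality $A^\bot\leq B^\bot$ iff $B\leq A$. -}

module Defs where

open import Data.Nat using (ℕ)
open import Data.Fin using (Fin)
open import Data.Unit using (⊤; tt)
open import Data.Empty using (⊥)
open import Data.Product using (Σ; _×_; _,_; proj₁; proj₂)
open import Data.Sum using (_⊎_; [_,_])
open import Function using (_∘_)
open import Function.Bundles using (_↔_)
open import Function.Definitions using (Bijective)
open import Relation.Nullary using (¬_)
open import Relation.Binary.PropositionalEquality using (_≡_)

-- Loci are sets (Agda types in Set).  Pullbacks in Set, canonically.

Pb : {A B C : Set} → (A → C) → (B → C) → Set
Pb {A} {B} f g = Σ A λ a → Σ B λ b → f a ≡ g b

pb₁ : {A B C : Set} {f : A → C} {g : B → C} → Pb f g → A
pb₁ (a , _ , _) = a

pb₂ : {A B C : Set} {f : A → C} {g : B → C} → Pb f g → B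
pb₂ (_ , b , _) = b

Empty : Set → Set
Empty P = ¬ P

cst : {I : Set} → I → ⊤ → I
cst x _ = x

Fibre : {J I : Set} → (J → I) → I → Set
Fibre {J} u x = Σ J λ y → u y ≡ x

QuasiInjective : {J I : Set} → (J → I) → Set
QuasiInjective u = ∀ x → Σ ℕ λ n → Fin n ↔ Fibre u x

IsCoproduct : {I J K : Set} → (I → K) → (J → K) → Set
IsCoproduct i j = Bijective _≡_ _≡_ [ i , j ]

-- Raw IndLL formulae, indexed by their locus.
-- A propositional variable is a name X : ℕ together with its locus J;
-- atom X f is f(X) (f : I → J), natom X f is f(X)^⊥.

data Form : Set → Set₁ where
  atom  : {I J : Set} → ℕ → (I → J) → Form I
  natom : {I J : Set} → ℕ → (I → J) → Form I
  𝟏 ⊤ᶠ ⊥ᶠ 𝟎 : {I : Set} → Form I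
  _⊗_ _⅋_ : {I : Set} → Form I → Form I → Form I
  with& plus⊕ : {I J K : Set} → Form I → (I → K) → (J → K) → Form J → Form K
  !ᶠ ?ᶠ : {I J : Set} → (J → I) → Form J → Form I

data WF : {I : Set} → Form I → Set₁ where
  wf-atom  : {I J : Set} {X : ℕ} {f : I → J} → QuasiInjective f → WF (atom X f)
  wf-natom : {I J : Set} {X : ℕ} {f : I → J} → QuasiInjective f → WF (natom X f)
  wf-𝟏 : {I : Set} → WF (𝟏 {I})
  wf-⊤ : {I : Set} → WF (⊤ᶠ {I})
  wf-⊥ : {I : Set} → WF (⊥ᶠ {I})
  wf-𝟎 : {I : Set} → WF (𝟎 {I})
  wf-⊗ : {I : Set} {A B : Form I} → WF A → WF B → WF (A ⊗ B)
  wf-⅋ : {I : Set} {A B : Form I} → WF A → WF B → WF (A ⅋ B)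
  wf-& : {I J K : Set} {A : Form I} {B : Form J} {i : I → K} {j : J → K} →
         IsCoproduct i j → WF A → WF B → WF (with& A i j B)
  wf-⊕ : {I J K : Set} {A : Form I} {B : Form J} {i : I → K} {j : J → K} →
         IsCoproduct i j → WF A → WF B → WF (plus⊕ A i j B)
  wf-! : {I J : Set} {u : J → I} {A : Form J} → QuasiInjective u → WF A → WF (!ᶠ u A)
  wf-? : {I J : Set} {u : J → I} {A : Form J} → QuasiInjective u → WF A → WF (?ᶠ u A)

bc : {I J : Set} → (I → J) → Form J → Form I
bc f (atom X g) = atom X (g ∘ f)
bc f (natom X g) = natom X (g ∘ f)
bc f 𝟏 = 𝟏
bc f ⊤ᶠ = ⊤ᶠ
bc f ⊥ᶠ = ⊥ᶠ
bc f 𝟎 = 𝟎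
bc f (A ⊗ B) = bc f A ⊗ bc f B
bc f (A ⅋ B) = bc f A ⅋ bc f B
bc f (with& A i j B) =
  with& (bc (pb₂ {f = f} {g = i}) A) (pb₁ {f = f} {g = i})
        (pb₁ {f = f} {g = j}) (bc (pb₂ {f = f} {g = j}) B)
bc f (plus⊕ A i j B) =
  plus⊕ (bc (pb₂ {f = f} {g = i}) A) (pb₁ {f = f} {g = i})
        (pb₁ {f = f} {g = j}) (bc (pb₂ {f = f} {g = j}) B)
bc f (!ᶠ u A) = !ᶠ (pb₁ {f = f} {g = u}) (bc (pb₂ {f = f} {g = u}) A)
bc f (?ᶠ u A) = ?ᶠ (pb₁ {f = f} {g = u}) (bc (pb₂ {f = f} {g = u}) A)

-- The rules for the
-- negative connectives are the ones obtained by duality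
-- (A^⊥ ≤ B^⊥ iff B ≤ A).  Equalities of maps (f = f', v = u ∘ g) are
-- read extensionally (pointwise).

infix 4 _≤_
data _≤_ : {I : Set} → Form I → Form I → Set₁ where
  ≤-atom  : {I J : Set} {X : ℕ} {f f' : I → J} →
            (∀ x → f x ≡ f' x) → atom X f ≤ atom X f'
  ≤-natom : {I J : Set} {X : ℕ} {f f' : I → J} →
            (∀ x → f x ≡ f' x) → natom X f ≤ natom X f'
  ≤-𝟏 : {I : Set} → 𝟏 {I} ≤ 𝟏
  ≤-⊤ : {I : Set} → ⊤ᶠ {I} ≤ ⊤ᶠ
  ≤-⊥ : {I : Set} → ⊥ᶠ {I} ≤ ⊥ᶠ
  ≤-𝟎 : {I : Set} → 𝟎 {I} ≤ 𝟎
  ≤-⊗ : {I : Set} {A A' B B' : Form I} → A ≤ A' → B ≤ B' → A ⊗ B ≤ A' ⊗ B'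
  ≤-⅋ : {I : Set} {A A' B B' : Form I} → A ≤ A' → B ≤ B' → A ⅋ B ≤ A' ⅋ B'
  ≤-! : {I J J' : Set} {u : J → I} {v : J' → I} {A : Form J} {A' : Form J'} →
        (g : J' → J) → (∀ y → v y ≡ u (g y)) →
        bc g A ≤ A' → !ᶠ u A ≤ !ᶠ v A'
  ≤-? : {I J J' : Set} {u : J → I} {v : J' → I} {A : Form J} {A' : Form J'} →
        (g : J → J') → (∀ y → u y ≡ v (g y)) →
        A ≤ bc g A' → ?ᶠ u A ≤ ?ᶠ v A'
  ≤-& : {I J I' J' K : Set} {A : Form I} {B : Form J} {A' : Form I'} {B' : Form J'}
        {i : I → K} {j : J → K} {i' : I' → K} {j' : J' → K} →
        Empty (Pb i j') → Empty (Pb j i') →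
        bc (pb₁ {f = i} {g = i'}) A ≤ bc (pb₂ {f = i} {g = i'}) A' →
        bc (pb₁ {f = j} {g = j'}) B ≤ bc (pb₂ {f = j} {g = j'}) B' →
        with& A i j B ≤ with& A' i' j' B'
  ≤-⊕ : {I J I' J' K : Set} {A : Form I} {B : Form J} {A' : Form I'} {B' : Form J'}
        {i : I → K} {j : J → K} {i' : I' → K} {j' : J' → K} →
        Empty (Pb i' j) → Empty (Pb j' i) →
        bc (pb₁ {f = i} {g = i'}) A ≤ bc (pb₂ {f = i} {g = i'}) A' →
        bc (pb₁ {f = j} {g = j'}) B ≤ bc (pb₂ {f = j} {g = j'}) B' →
        plus⊕ A i j B ≤ plus⊕ A' i' j' B'

{-# OPTIONS --safe #-}
-- For A and B of the same shape, cst_a(A) ≤ cst_a'(B) unfolds to a relation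
-- Pointwise≤ between the fibres of A at a and of B at a'. Since the premises of
-- the rules for &, ⊕ and ! base-change along pullbacks of pullbacks, the induction
-- is run for any X that is a weak base change of A along some ρ : L → K (every
-- square surjects onto the true pullback): then X ≤ Y iff A at ρ l is pointwise
-- below B at ρ' l for all l. The theorem is the case ρ = ρ' = id. The common shape
-- is read off from one fibre, which is the only use of a point of I.
module Submission where

open import Defs
open import Data.Empty using (⊥)
open import Data.Nat using (ℕ)
open import Data.Product using (Σ-syntax; ∃-syntax; _×_; _,_; proj₁; proj₂; uncurry)
open import Data.Unit using (⊤; tt)
open import Function using (id; _∘_)
open import Relation.Binary.PropositionalEquality
  using (_≡_; _≗_; refl; sym; trans; cong)

private
  variable
    I I' I₁ I₁' J J' J₁ K K' L M : Set

record WeakPullback (ρ : L → K) (i : I → K) (i₁ : I₁ → L) (σ : I₁ → I) : Set where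
  field
    commute : ρ ∘ i₁ ≗ i ∘ σ
    lift    : (x : Pb ρ i) → Σ[ p ∈ I₁ ] i₁ p ≡ pb₁ x × σ p ≡ pb₂ x

open WeakPullback

weakPullback-id : (i : I → K) → WeakPullback id i i id
weakPullback-id _ = record
  { commute = λ _ → refl
  ; lift    = λ (_ , b , e) → b , sym e , refl
  }

weakPullback-paste : {ρ : L → K} {i : I → K} {i₁ : I₁ → L} {σ : I₁ → I} →
                     WeakPullback ρ i i₁ σ → (f : M → L) →
                     WeakPullback (ρ ∘ f) i (pb₁ {f = f} {g = i₁}) (σ ∘ pb₂)
weakPullback-paste {ρ = ρ} w f = record
  { commute = λ (_ , p , e) → trans (cong ρ e) (commute w p)
  ; lift    = λ (m , b , e) → let p , p≡ , σp≡ = lift w (f m , b , e) in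
                              (m , p , sym p≡) , refl , σp≡
  }

data WeakBaseChange : {L K : Set} → (L → K) → Form K → Form L → Set₁ where
  wbc-atom  : {ρ : L → K} {n : ℕ} {f : K → J} {f' : L → J} →
              f' ≗ f ∘ ρ → WeakBaseChange ρ (atom n f) (atom n f')
  wbc-natom : {ρ : L → K} {n : ℕ} {f : K → J} {f' : L → J} →
              f' ≗ f ∘ ρ → WeakBaseChange ρ (natom n f) (natom n f')
  wbc-𝟏 : {ρ : L → K} → WeakBaseChange ρ 𝟏 𝟏
  wbc-⊤ : {ρ : L → K} → WeakBaseChange ρ ⊤ᶠ ⊤ᶠ
  wbc-⊥ : {ρ : L → K} → WeakBaseChange ρ ⊥ᶠ ⊥ᶠ
  wbc-𝟎 : {ρ : L → K} → WeakBaseChange ρ 𝟎 𝟎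
  wbc-⊗ : {ρ : L → K} {A B : Form K} {X Y : Form L} →
          WeakBaseChange ρ A X → WeakBaseChange ρ B Y → WeakBaseChange ρ (A ⊗ B) (X ⊗ Y)
  wbc-⅋ : {ρ : L → K} {A B : Form K} {X Y : Form L} →
          WeakBaseChange ρ A X → WeakBaseChange ρ B Y → WeakBaseChange ρ (A ⅋ B) (X ⅋ Y)
  wbc-& : {ρ : L → K} {A : Form I} {B : Form J} {X : Form I₁} {Y : Form J₁}
          {i : I → K} {j : J → K} {i₁ : I₁ → L} {j₁ : J₁ → L}
          {σ : I₁ → I} {τ : J₁ → J} →
          WeakPullback ρ i i₁ σ → WeakPullback ρ j j₁ τ →
          WeakBaseChange σ A X → WeakBaseChange τ B Y →
          WeakBaseChange ρ (with& A i j B) (with& X i₁ j₁ Y)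
  wbc-⊕ : {ρ : L → K} {A : Form I} {B : Form J} {X : Form I₁} {Y : Form J₁}
          {i : I → K} {j : J → K} {i₁ : I₁ → L} {j₁ : J₁ → L}
          {σ : I₁ → I} {τ : J₁ → J} →
          WeakPullback ρ i i₁ σ → WeakPullback ρ j j₁ τ →
          WeakBaseChange σ A X → WeakBaseChange τ B Y →
          WeakBaseChange ρ (plus⊕ A i j B) (plus⊕ X i₁ j₁ Y)
  wbc-! : {ρ : L → K} {A : Form J} {X : Form J₁} {u : J → K} {u₁ : J₁ → L}
          {σ : J₁ → J} → WeakPullback ρ u u₁ σ → WeakBaseChange σ A X →
          WeakBaseChange ρ (!ᶠ u A) (!ᶠ u₁ X)
  wbc-? : {ρ : L → K} {A : Form J} {X : Form J₁} {u : J → K} {u₁ : J₁ → L}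
          {σ : J₁ → J} → WeakPullback ρ u u₁ σ → WeakBaseChange σ A X →
          WeakBaseChange ρ (?ᶠ u A) (?ᶠ u₁ X)

weakBaseChange-id : (A : Form I) → WeakBaseChange id A A
weakBaseChange-id (atom _ _)      = wbc-atom (λ _ → refl)
weakBaseChange-id (natom _ _)     = wbc-natom (λ _ → refl)
weakBaseChange-id 𝟏               = wbc-𝟏
weakBaseChange-id ⊤ᶠ              = wbc-⊤
weakBaseChange-id ⊥ᶠ              = wbc-⊥
weakBaseChange-id 𝟎               = wbc-𝟎
weakBaseChange-id (A ⊗ B)         = wbc-⊗ (weakBaseChange-id A) (weakBaseChange-id B)
weakBaseChange-id (A ⅋ B)         = wbc-⅋ (weakBaseChange-id A) (weakBaseChange-id B)
weakBaseChange-id (with& A i j B) =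
  wbc-& (weakPullback-id i) (weakPullback-id j) (weakBaseChange-id A) (weakBaseChange-id B)
weakBaseChange-id (plus⊕ A i j B) =
  wbc-⊕ (weakPullback-id i) (weakPullback-id j) (weakBaseChange-id A) (weakBaseChange-id B)
weakBaseChange-id (!ᶠ u A)        = wbc-! (weakPullback-id u) (weakBaseChange-id A)
weakBaseChange-id (?ᶠ u A)        = wbc-? (weakPullback-id u) (weakBaseChange-id A)

weakBaseChange-bc : {ρ : L → K} {A : Form K} {X : Form L} →
                    WeakBaseChange ρ A X → (f : M → L) → WeakBaseChange (ρ ∘ f) A (bc f X)
weakBaseChange-bc (wbc-atom e)  f = wbc-atom (e ∘ f)
weakBaseChange-bc (wbc-natom e) f = wbc-natom (e ∘ f)
weakBaseChange-bc wbc-𝟏         f = wbc-𝟏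
weakBaseChange-bc wbc-⊤         f = wbc-⊤
weakBaseChange-bc wbc-⊥         f = wbc-⊥
weakBaseChange-bc wbc-𝟎         f = wbc-𝟎
weakBaseChange-bc (wbc-⊗ a b)   f = wbc-⊗ (weakBaseChange-bc a f) (weakBaseChange-bc b f)
weakBaseChange-bc (wbc-⅋ a b)   f = wbc-⅋ (weakBaseChange-bc a f) (weakBaseChange-bc b f)
weakBaseChange-bc (wbc-& wi wj a b) f =
  wbc-& (weakPullback-paste wi f) (weakPullback-paste wj f)
        (weakBaseChange-bc a pb₂) (weakBaseChange-bc b pb₂)
weakBaseChange-bc (wbc-⊕ wi wj a b) f =
  wbc-⊕ (weakPullback-paste wi f) (weakPullback-paste wj f)
        (weakBaseChange-bc a pb₂) (weakBaseChange-bc b pb₂)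
weakBaseChange-bc (wbc-! w a) f = wbc-! (weakPullback-paste w f) (weakBaseChange-bc a pb₂)
weakBaseChange-bc (wbc-? w a) f = wbc-? (weakPullback-paste w f) (weakBaseChange-bc a pb₂)

data SameShape : {I I' : Set} → Form I → Form I' → Set₁ where
  same-atom  : {n : ℕ} {f : I → J} {f' : I' → J} → SameShape (atom n f) (atom n f')
  same-natom : {n : ℕ} {f : I → J} {f' : I' → J} → SameShape (natom n f) (natom n f')
  same-𝟏 : SameShape (𝟏 {I}) (𝟏 {I'})
  same-⊤ : SameShape (⊤ᶠ {I}) (⊤ᶠ {I'})
  same-⊥ : SameShape (⊥ᶠ {I}) (⊥ᶠ {I'})
  same-𝟎 : SameShape (𝟎 {I}) (𝟎 {I'})
  same-⊗ : {A B : Form I} {A' B' : Form I'} →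
           SameShape A A' → SameShape B B' → SameShape (A ⊗ B) (A' ⊗ B')
  same-⅋ : {A B : Form I} {A' B' : Form I'} →
           SameShape A A' → SameShape B B' → SameShape (A ⅋ B) (A' ⅋ B')
  same-& : {A : Form I} {B : Form J} {A' : Form I'} {B' : Form J'}
           {i : I → K} {j : J → K} {i' : I' → K'} {j' : J' → K'} →
           SameShape A A' → SameShape B B' → SameShape (with& A i j B) (with& A' i' j' B')
  same-⊕ : {A : Form I} {B : Form J} {A' : Form I'} {B' : Form J'}
           {i : I → K} {j : J → K} {i' : I' → K'} {j' : J' → K'} →
           SameShape A A' → SameShape B B' → SameShape (plus⊕ A i j B) (plus⊕ A' i' j' B')
  same-! : {A : Form J} {A' : Form J'} {u : J → I} {v : J' → I'} →
           SameShape A A' → SameShape (!ᶠ u A) (!ᶠ v A')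
  same-? : {A : Form J} {A' : Form J'} {u : J → I} {v : J' → I'} →
           SameShape A A' → SameShape (?ᶠ u A) (?ᶠ v A')

record Additive≤ (i : I → K) (j : J → K) (i' : I' → K') (j' : J' → K')
                 (R : I → I' → Set) (S : J → J' → Set) (a : K) (a' : K') : Set where
  field
    left             : ∀ b b' → a ≡ i b → a' ≡ i' b' → R b b'
    right            : ∀ c c' → a ≡ j c → a' ≡ j' c' → S c c'
    left-right-apart : ∀ b c' → a ≡ i b → a' ≡ j' c' → ⊥
    right-left-apart : ∀ c b' → a ≡ j c → a' ≡ i' b' → ⊥

open Additive≤

Pointwise≤ : {A : Form I} {A' : Form I'} → SameShape A A' → I → I' → Set
Pointwise≤ (same-atom {f = f} {f' = f'})  a a' = f a ≡ f' a'
Pointwise≤ (same-natom {f = f} {f' = f'}) a a' = f a ≡ f' a'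
Pointwise≤ same-𝟏 _ _ = ⊤
Pointwise≤ same-⊤ _ _ = ⊤
Pointwise≤ same-⊥ _ _ = ⊤
Pointwise≤ same-𝟎 _ _ = ⊤
Pointwise≤ (same-⊗ s t) a a' = Pointwise≤ s a a' × Pointwise≤ t a a'
Pointwise≤ (same-⅋ s t) a a' = Pointwise≤ s a a' × Pointwise≤ t a a'
Pointwise≤ (same-& {i = i} {j} {i'} {j'} s t) a a' =
  Additive≤ i j i' j' (Pointwise≤ s) (Pointwise≤ t) a a'
Pointwise≤ (same-⊕ {i = i} {j} {i'} {j'} s t) a a' =
  Additive≤ i j i' j' (Pointwise≤ s) (Pointwise≤ t) a a'
Pointwise≤ (same-! {u = u} {v} s) a a' =
  ∀ y' → a' ≡ v y' → ∃[ y ] a ≡ u y × Pointwise≤ s y y'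
Pointwise≤ (same-? {u = u} {v} s) a a' =
  ∀ y → a ≡ u y → ∃[ y' ] a' ≡ v y' × Pointwise≤ s y y'

lift-pointwise : {ρ : L → K} {ρ' : L → K'} {i : I → K} {i' : I' → K'}
                 {i₁ : I₁ → L} {i₁' : I₁' → L} {σ : I₁ → I} {σ' : I₁' → I'}
                 {R : I → I' → Set} {l : L} {b : I} {b' : I'} →
                 WeakPullback ρ i i₁ σ → WeakPullback ρ' i' i₁' σ' →
                 ((p : Pb i₁ i₁') → R (σ (pb₁ p)) (σ' (pb₂ p))) →
                 ρ l ≡ i b → ρ' l ≡ i' b' → R b b'
lift-pointwise w w' R-pb e e' with lift w (_ , _ , e) | lift w' (_ , _ , e')
... | p , p≡ , refl | p' , p'≡ , refl = R-pb (p , p' , trans p≡ (sym p'≡))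

commute-pb : {ρ : L → K} {ρ' : L → K'} {i : I → K} {i' : I' → K'}
             {i₁ : I₁ → L} {i₁' : I₁' → L} {σ : I₁ → I} {σ' : I₁' → I'}
             {q : I₁} {q' : I₁'} →
             WeakPullback ρ i i₁ σ → WeakPullback ρ' i' i₁' σ' →
             i₁ q ≡ i₁' q' → ρ (i₁ q) ≡ i (σ q) × ρ' (i₁ q) ≡ i' (σ' q')
commute-pb {ρ' = ρ'} {q = q} {q'} w w' e = commute w q , trans (cong ρ' e) (commute w' q')

≤⇒sameShape : {ρ : L → K} {ρ' : L → K'} {A : Form K} {B : Form K'} {X Y : Form L} →
              WeakBaseChange ρ A X → WeakBaseChange ρ' B Y → X ≤ Y → SameShape A B
≤⇒sameShape (wbc-atom _)  (wbc-atom _)  (≤-atom _)  = same-atom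
≤⇒sameShape (wbc-natom _) (wbc-natom _) (≤-natom _) = same-natom
≤⇒sameShape wbc-𝟏 wbc-𝟏 ≤-𝟏 = same-𝟏
≤⇒sameShape wbc-⊤ wbc-⊤ ≤-⊤ = same-⊤
≤⇒sameShape wbc-⊥ wbc-⊥ ≤-⊥ = same-⊥
≤⇒sameShape wbc-𝟎 wbc-𝟎 ≤-𝟎 = same-𝟎
≤⇒sameShape (wbc-⊗ a b) (wbc-⊗ a' b') (≤-⊗ d₁ d₂) =
  same-⊗ (≤⇒sameShape a a' d₁) (≤⇒sameShape b b' d₂)
≤⇒sameShape (wbc-⅋ a b) (wbc-⅋ a' b') (≤-⅋ d₁ d₂) =
  same-⅋ (≤⇒sameShape a a' d₁) (≤⇒sameShape b b' d₂)
≤⇒sameShape (wbc-& _ _ a b) (wbc-& _ _ a' b') (≤-& _ _ d₁ d₂) =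
  same-& (≤⇒sameShape (weakBaseChange-bc a pb₁) (weakBaseChange-bc a' pb₂) d₁)
         (≤⇒sameShape (weakBaseChange-bc b pb₁) (weakBaseChange-bc b' pb₂) d₂)
≤⇒sameShape (wbc-⊕ _ _ a b) (wbc-⊕ _ _ a' b') (≤-⊕ _ _ d₁ d₂) =
  same-⊕ (≤⇒sameShape (weakBaseChange-bc a pb₁) (weakBaseChange-bc a' pb₂) d₁)
         (≤⇒sameShape (weakBaseChange-bc b pb₁) (weakBaseChange-bc b' pb₂) d₂)
≤⇒sameShape (wbc-! _ a) (wbc-! _ b) (≤-! g _ d) =
  same-! (≤⇒sameShape (weakBaseChange-bc a g) b d)
≤⇒sameShape (wbc-? _ a) (wbc-? _ b) (≤-? g _ d) =
  same-? (≤⇒sameShape a (weakBaseChange-bc b g) d)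

≤⇒pointwise≤ : {ρ : L → K} {ρ' : L → K'} {A : Form K} {B : Form K'} {X Y : Form L} →
               (s : SameShape A B) → WeakBaseChange ρ A X → WeakBaseChange ρ' B Y →
               X ≤ Y → ∀ l → Pointwise≤ s (ρ l) (ρ' l)
≤⇒pointwise≤ same-atom  (wbc-atom e)  (wbc-atom e')  (≤-atom h)  l =
  trans (sym (e l)) (trans (h l) (e' l))
≤⇒pointwise≤ same-natom (wbc-natom e) (wbc-natom e') (≤-natom h) l =
  trans (sym (e l)) (trans (h l) (e' l))
≤⇒pointwise≤ same-𝟏 wbc-𝟏 wbc-𝟏 ≤-𝟏 _ = tt
≤⇒pointwise≤ same-⊤ wbc-⊤ wbc-⊤ ≤-⊤ _ = tt
≤⇒pointwise≤ same-⊥ wbc-⊥ wbc-⊥ ≤-⊥ _ = tt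
≤⇒pointwise≤ same-𝟎 wbc-𝟎 wbc-𝟎 ≤-𝟎 _ = tt
≤⇒pointwise≤ (same-⊗ s t) (wbc-⊗ a b) (wbc-⊗ a' b') (≤-⊗ d₁ d₂) l =
  ≤⇒pointwise≤ s a a' d₁ l , ≤⇒pointwise≤ t b b' d₂ l
≤⇒pointwise≤ (same-⅋ s t) (wbc-⅋ a b) (wbc-⅋ a' b') (≤-⅋ d₁ d₂) l =
  ≤⇒pointwise≤ s a a' d₁ l , ≤⇒pointwise≤ t b b' d₂ l
≤⇒pointwise≤ (same-& s t) (wbc-& wi wj a b) (wbc-& wi' wj' a' b')
             (≤-& no₁ no₂ d₁ d₂) _ = record
  { left             = λ _ _ → lift-pointwise wi wi'
      (≤⇒pointwise≤ s (weakBaseChange-bc a pb₁) (weakBaseChange-bc a' pb₂) d₁)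
  ; right            = λ _ _ → lift-pointwise wj wj'
      (≤⇒pointwise≤ t (weakBaseChange-bc b pb₁) (weakBaseChange-bc b' pb₂) d₂)
  ; left-right-apart = λ _ _ → lift-pointwise {R = λ _ _ → ⊥} wi wj' no₁
  ; right-left-apart = λ _ _ → lift-pointwise {R = λ _ _ → ⊥} wj wi' no₂
  }
≤⇒pointwise≤ (same-⊕ s t) (wbc-⊕ wi wj a b) (wbc-⊕ wi' wj' a' b')
             (≤-⊕ no₁ no₂ d₁ d₂) _ = record
  { left             = λ _ _ → lift-pointwise wi wi'
      (≤⇒pointwise≤ s (weakBaseChange-bc a pb₁) (weakBaseChange-bc a' pb₂) d₁)
  ; right            = λ _ _ → lift-pointwise wj wj'
      (≤⇒pointwise≤ t (weakBaseChange-bc b pb₁) (weakBaseChange-bc b' pb₂) d₂)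
  ; left-right-apart = λ _ _ e e' → lift-pointwise {R = λ _ _ → ⊥} wj' wi no₂ e' e
  ; right-left-apart = λ _ _ e e' → lift-pointwise {R = λ _ _ → ⊥} wi' wj no₁ e' e
  }
≤⇒pointwise≤ {ρ = ρ} (same-! s) (wbc-! w a) (wbc-! w' b) (≤-! g v₁≡u₁∘g d) l y' e
  with lift w' (l , y' , e)
... | y₂ , refl , refl =
  _ , trans (cong ρ (v₁≡u₁∘g y₂)) (commute w (g y₂)) ,
  ≤⇒pointwise≤ s (weakBaseChange-bc a g) b d y₂
≤⇒pointwise≤ {ρ' = ρ'} (same-? s) (wbc-? w a) (wbc-? w' b) (≤-? g u₁≡v₁∘g d) l y e
  with lift w (l , y , e)
... | y₁ , refl , refl =
  _ , trans (cong ρ' (u₁≡v₁∘g y₁)) (commute w' (g y₁)) ,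
  ≤⇒pointwise≤ s a (weakBaseChange-bc b g) d y₁

pointwise≤⇒≤ : {ρ : L → K} {ρ' : L → K'} {A : Form K} {B : Form K'} {X Y : Form L} →
               (s : SameShape A B) → WeakBaseChange ρ A X → WeakBaseChange ρ' B Y →
               (∀ l → Pointwise≤ s (ρ l) (ρ' l)) → X ≤ Y
pointwise≤⇒≤ same-atom  (wbc-atom e)  (wbc-atom e')  P =
  ≤-atom λ l → trans (e l) (trans (P l) (sym (e' l)))
pointwise≤⇒≤ same-natom (wbc-natom e) (wbc-natom e') P =
  ≤-natom λ l → trans (e l) (trans (P l) (sym (e' l)))
pointwise≤⇒≤ same-𝟏 wbc-𝟏 wbc-𝟏 _ = ≤-𝟏
pointwise≤⇒≤ same-⊤ wbc-⊤ wbc-⊤ _ = ≤-⊤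
pointwise≤⇒≤ same-⊥ wbc-⊥ wbc-⊥ _ = ≤-⊥
pointwise≤⇒≤ same-𝟎 wbc-𝟎 wbc-𝟎 _ = ≤-𝟎
pointwise≤⇒≤ (same-⊗ s t) (wbc-⊗ a b) (wbc-⊗ a' b') P =
  ≤-⊗ (pointwise≤⇒≤ s a a' (proj₁ ∘ P)) (pointwise≤⇒≤ t b b' (proj₂ ∘ P))
pointwise≤⇒≤ (same-⅋ s t) (wbc-⅋ a b) (wbc-⅋ a' b') P =
  ≤-⅋ (pointwise≤⇒≤ s a a' (proj₁ ∘ P)) (pointwise≤⇒≤ t b b' (proj₂ ∘ P))
pointwise≤⇒≤ (same-& s t) (wbc-& wi wj a b) (wbc-& wi' wj' a' b') P = ≤-&
  (λ (_ , _ , e) → uncurry (left-right-apart (P _) _ _) (commute-pb wi wj' e))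
  (λ (_ , _ , e) → uncurry (right-left-apart (P _) _ _) (commute-pb wj wi' e))
  (pointwise≤⇒≤ s (weakBaseChange-bc a pb₁) (weakBaseChange-bc a' pb₂)
     λ (_ , _ , e) → uncurry (left (P _) _ _) (commute-pb wi wi' e))
  (pointwise≤⇒≤ t (weakBaseChange-bc b pb₁) (weakBaseChange-bc b' pb₂)
     λ (_ , _ , e) → uncurry (right (P _) _ _) (commute-pb wj wj' e))
pointwise≤⇒≤ (same-⊕ s t) (wbc-⊕ wi wj a b) (wbc-⊕ wi' wj' a' b') P = ≤-⊕
  (λ (_ , _ , e) → uncurry (right-left-apart (P _) _ _) (commute-pb wj wi' (sym e)))
  (λ (_ , _ , e) → uncurry (left-right-apart (P _) _ _) (commute-pb wi wj' (sym e)))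
  (pointwise≤⇒≤ s (weakBaseChange-bc a pb₁) (weakBaseChange-bc a' pb₂)
     λ (_ , _ , e) → uncurry (left (P _) _ _) (commute-pb wi wi' e))
  (pointwise≤⇒≤ t (weakBaseChange-bc b pb₁) (weakBaseChange-bc b' pb₂)
     λ (_ , _ , e) → uncurry (right (P _) _ _) (commute-pb wj wj' e))
pointwise≤⇒≤ (same-! s) (wbc-! {u₁ = u₁} {σ = σ} w a)
             (wbc-! {u₁ = v₁} {σ = σ'} w' b) P =
  ≤-! (proj₁ ∘ below) (sym ∘ proj₁ ∘ proj₂ ∘ below)
      (pointwise≤⇒≤ s (weakBaseChange-bc a (proj₁ ∘ below)) b
                     (proj₂ ∘ proj₂ ∘ below))
  where
  below : ∀ y₂ → Σ[ p ∈ _ ] u₁ p ≡ v₁ y₂ × Pointwise≤ s (σ p) (σ' y₂)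
  below y₂ with P (v₁ y₂) (σ' y₂) (commute w' y₂)
  ... | y , e , y≤ with lift w (v₁ y₂ , y , e)
  ...   | p , u₁p≡ , refl = p , u₁p≡ , y≤
pointwise≤⇒≤ (same-? s) (wbc-? {u₁ = u₁} {σ = σ} w a)
             (wbc-? {u₁ = v₁} {σ = σ'} w' b) P =
  ≤-? (proj₁ ∘ above) (sym ∘ proj₁ ∘ proj₂ ∘ above)
      (pointwise≤⇒≤ s a (weakBaseChange-bc b (proj₁ ∘ above))
                     (proj₂ ∘ proj₂ ∘ above))
  where
  above : ∀ y₁ → Σ[ p ∈ _ ] v₁ p ≡ u₁ y₁ × Pointwise≤ s (σ y₁) (σ' p)
  above y₁ with P (u₁ y₁) (σ y₁) (commute w y₁)
  ... | y' , e , ≤y' with lift w' (u₁ y₁ , y' , e)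
  ...   | p , v₁p≡ , refl = p , v₁p≡ , ≤y'

lemma2p11 : {I : Set} → I → (A B : Form I) → WF A → WF B →
              (∀ (x : I) → bc (cst x) A ≤ bc (cst x) B) → A ≤ B
lemma2p11 {I} x₀ A B _ _ A≤B-at =
  pointwise≤⇒≤ shape (weakBaseChange-id A) (weakBaseChange-id B)
    λ x → ≤⇒pointwise≤ shape (atFibre A x) (atFibre B x) (A≤B-at x) tt
  where
  atFibre : (C : Form I) (x : I) → WeakBaseChange (cst x) C (bc (cst x) C)
  atFibre C = weakBaseChange-bc (weakBaseChange-id C) ∘ cst

  shape : SameShape A B
  shape = ≤⇒sameShape (atFibre A x₀) (atFibre B x₀) (A≤B-at x₀)
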